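{- Let $\mathcal{Q}=(Q,\rho)$ be a quasimetric space with betweenness $\mathcal{B}$, and let $x,y,z\in Q$ be such that $\mathcal{B}(\{x,y,z\})=\{xzy\}$. Then $\mathcal{Q}$ has a universal line or $\lvert\mathcal{L}_\mathcal{Q}\rvert\geq 5$.
   Context: A quasimetric space is a pair $(Q,\rho)$ where $Q$ is a set and $\rho:Q\times Q\to[0,\infty)$ satisfies $\rho(x,y)=0\iff x=y$ and $\rho(x,y)\le \rho(x,z)+\rho(z,y)$ for all $x,y,z\in Q$ ($\rho$ need not be symmetric). For $a,b\in Q$ let $[ab]=\{c\in Q:\rho(a,b)=\rho(a,c)+\rho(c,b)\}$. For distinct $a,b\in Q$, the line $\overrightarrow{ab}=\{c\in Q: a\in[cb]\ \text{or}\ c\in[ab]\ \text{or}\ b\in[ac]\}$. $\mathcal{L}_\mathcal{Q}$ is the set of all lines $\overrightarrow{ab}$ with $a\neq b$; a line is universal if it equals $Q$. The betweenness $\mathcal{B}$ is the set of ordered triples $(a,b,c)$ of pairwise distinct points with $\rho(a,b)+\rho(b,c)=\rho(a,c)$, written $abc$. For $S\subseteq Q$, $\mathcal{B}(S)=\{abc\in\mathcal{B}: a,b,c\in S\}$. -}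

module Defs where

open import Data.Product using (Σ; ∃; _×_; _,_; proj₁; proj₂)
open import Data.Sum using (_⊎_)
open import Data.Fin using (Fin)
open import Data.Empty using (⊥)
open import Relation.Nullary using (¬_)
open import Relation.Binary.PropositionalEquality using (_≡_; _≢_)

-- The real numbers, axiomatised as a complete ordered field
-- (any two models are isomorphic, so quantifying over all models
-- is the same as fixing ℝ).
record RealField : Set₁ where
  infixl 6 _+_
  infixl 7 _*_
  infix 4 _≤_
  field
    Carrier : Set
    0# 1#   : Carrier
    _+_ _*_ : Carrier → Carrier → Carrier
    -_      : Carrier → Carrier
    _≤_     : Carrier → Carrier → Set
    +-assoc  : ∀ x y z → (x + y) + z ≡ x + (y + z)
    +-comm   : ∀ x y → x + y ≡ y + x
    +-idʳ    : ∀ x → x + 0# ≡ x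
    +-invʳ   : ∀ x → x + (- x) ≡ 0#
    *-assoc  : ∀ x y z → (x * y) * z ≡ x * (y * z)
    *-comm   : ∀ x y → x * y ≡ y * x
    *-idʳ    : ∀ x → x * 1# ≡ x
    distribˡ : ∀ x y z → x * (y + z) ≡ x * y + x * z
    *-inv    : ∀ x → x ≢ 0# → Σ Carrier (λ y → x * y ≡ 1#)
    0≢1      : 0# ≢ 1#
    ≤-refl    : ∀ x → x ≤ x
    ≤-trans   : ∀ {x y z} → x ≤ y → y ≤ z → x ≤ z
    ≤-antisym : ∀ {x y} → x ≤ y → y ≤ x → x ≡ y
    ≤-total   : ∀ x y → x ≤ y ⊎ y ≤ x
    +-mono    : ∀ {x y} z → x ≤ y → x + z ≤ y + z
    *-nonneg  : ∀ {x y} → 0# ≤ x → 0# ≤ y → 0# ≤ x * y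
    complete  : (P : Carrier → Set) → Σ Carrier P →
                Σ Carrier (λ b → ∀ x → P x → x ≤ b) →
                Σ Carrier (λ s → (∀ x → P x → x ≤ s) ×
                                 (∀ b → (∀ x → P x → x ≤ b) → s ≤ b))

record Quasimetric (ℝ : RealField) : Set₁ where
  open RealField ℝ
  field
    Q     : Set
    ρ     : Q → Q → Carrier
    nonneg : ∀ x y → 0# ≤ ρ x y
    zero⇒eq : ∀ x y → ρ x y ≡ 0# → x ≡ y
    eq⇒zero : ∀ x → ρ x x ≡ 0#
    triangle : ∀ x y z → ρ x y ≤ ρ x z + ρ z y

module _ {ℝ : RealField} (𝒬 : Quasimetric ℝ) where
  open RealField ℝ
  open Quasimetric 𝒬

  _∈[_,_] : Q → Q → Q → Set
  c ∈[ a , b ] = ρ a b ≡ ρ a c + ρ c b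

  _∈Line_,_ : Q → Q → Q → Set
  c ∈Line a , b = (a ∈[ c , b ]) ⊎ (c ∈[ a , b ]) ⊎ (b ∈[ a , c ])

  Betw : Q → Q → Q → Set
  Betw a b c = a ≢ b × b ≢ c × a ≢ c × (ρ a b + ρ b c ≡ ρ a c)

  SameLine : Q × Q → Q × Q → Set
  SameLine (a , b) (a' , b') =
    ∀ c → ((c ∈Line a , b) → (c ∈Line a' , b')) × ((c ∈Line a' , b') → (c ∈Line a , b))

  HasUniversalLine : Set
  HasUniversalLine = Σ Q λ a → Σ Q λ b → a ≢ b × (∀ c → c ∈Line a , b)

  AtLeast5Lines : Set
  AtLeast5Lines = Σ (Fin 5 → Q × Q) λ f →
    (∀ i → proj₁ (f i) ≢ proj₂ (f i)) ×
    (∀ i j → SameLine (f i) (f j) → i ≡ j)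

  In3 : Q → Q → Q → Q → Set
  In3 x y z a = a ≡ x ⊎ a ≡ y ⊎ a ≡ z

  OnlyBetw : Q → Q → Q → Set
  OnlyBetw x y z = Betw x z y ×
    (∀ a b c → In3 x y z a → In3 x y z b → In3 x y z c →
      Betw a b c → (a ≡ x × b ≡ z × c ≡ y))

-- The lines L(x,y), L(y,x), L(z,x), L(y,z) are pairwise distinct: their traces on {x, y, z}
-- are {x,y,z}, {x,y}, {x,z} and {y,z}. Hence a line other than L(x,y) whose trace is all of
-- {x, y, z} or a single point is a fifth line. L(x,z) and L(z,y) have full trace, so we may
-- assume L(x,y) = L(x,z) = L(z,y); if this line is not universal, pick w outside it. Deciding
-- the betweenness relations among x, y, z, w that this leaves open, either some line through w
-- has full or singleton trace, or the relations add up, via the triangle inequality, to a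
-- betweenness that is excluded (or to w = x).

module Submission where

open import Defs using (RealField; Quasimetric; HasUniversalLine; AtLeast5Lines; OnlyBetw)
open import Algebra.Bundles using (AbelianGroup)
open import Axiom.DoubleNegationElimination using (em⇒dne)
open import Axiom.ExcludedMiddle using (ExcludedMiddle)
open import Data.Empty using (⊥-elim)
open import Data.Product using (∃; _×_; _,_; proj₁; proj₂; uncurry)
open import Data.Sum using (_⊎_; inj₁; inj₂)
open import Data.Vec using (Vec; []; _∷_; lookup)
open import Data.Vec.Relation.Unary.All using (All; []; _∷_)
open import Data.Vec.Relation.Unary.All.Properties using (lookup⁺)
open import Function using (_∘_)
open import Level using (0ℓ)
open import Relation.Binary.Bundles using (Setoid)
open import Relation.Binary.PropositionalEquality
open import Relation.Binary.PropositionalEquality.Algebra using (isMagma)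
open import Relation.Nullary using (¬_; yes; no)
import Algebra.Properties.AbelianGroup as AbelianGroupProperties
import Algebra.Solver.CommutativeMonoid as CommutativeMonoidSolver
import Data.Vec.Relation.Unary.Unique.Setoid as Unique
import Data.Vec.Relation.Unary.Unique.Setoid.Properties as UniqueProperties

em⇒∀⊎∃¬ : ExcludedMiddle 0ℓ → {A : Set} (P : A → Set) → (∀ a → P a) ⊎ ∃ (¬_ ∘ P)
em⇒∀⊎∃¬ em P with em {∃ (¬_ ∘ P)}
... | yes counterexample = inj₂ counterexample
... | no ¬counterexample = inj₁ λ a → em⇒dne em (¬counterexample ∘ (a ,_))

module RealFieldProperties (ℝ : RealField) where
  open RealField ℝ

  +-identityˡ : ∀ x → 0# + x ≡ x
  +-identityˡ x = trans (+-comm 0# x) (+-idʳ x)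

  +-abelianGroup : AbelianGroup 0ℓ 0ℓ
  +-abelianGroup = record
    { Carrier = Carrier ; _≈_ = _≡_ ; _∙_ = _+_ ; ε = 0# ; _⁻¹ = -_
    ; isAbelianGroup = record
      { isGroup = record
        { isMonoid = record
          { isSemigroup = record { isMagma = isMagma _+_ ; assoc = +-assoc }
          ; identity = +-identityˡ , +-idʳ }
        ; inverse = (λ x → trans (+-comm (- x) x) (+-invʳ x)) , +-invʳ
        ; ⁻¹-cong = cong -_ }
      ; comm = +-comm } }

  open AbelianGroup +-abelianGroup public using (commutativeMonoid)
  open AbelianGroupProperties +-abelianGroup public using (//-rightDividesʳ; identityʳ-unique)

  +-mono-≤ : ∀ {a b c d} → a ≤ b → c ≤ d → a + c ≤ b + d
  +-mono-≤ {a} {b} {c} {d} a≤b c≤d =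
    ≤-trans (+-mono c a≤b) (subst₂ _≤_ (+-comm c b) (+-comm d b) (+-mono b c≤d))

  +-cancelʳ-≤ : ∀ {a b} c → a + c ≤ b + c → a ≤ b
  +-cancelʳ-≤ {a} {b} c a+c≤b+c =
    subst₂ _≤_ (//-rightDividesʳ c a) (//-rightDividesʳ c b) (+-mono (- c) a+c≤b+c)

  x+y≡0⇒x≡0 : ∀ {x y} → 0# ≤ x → 0# ≤ y → x + y ≡ 0# → x ≡ 0#
  x+y≡0⇒x≡0 {x} {y} 0≤x 0≤y x+y≡0 =
    ≤-antisym (subst₂ _≤_ (+-idʳ x) x+y≡0 (+-mono-≤ (≤-refl x) 0≤y)) 0≤x

conjugate : {ℝ : RealField} → Quasimetric ℝ → Quasimetric ℝ
conjugate {ℝ} 𝒬 = record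
  { Q = Q
  ; ρ = λ a b → ρ b a
  ; nonneg = λ a b → nonneg b a
  ; zero⇒eq = λ a b ρba≡0 → sym (zero⇒eq b a ρba≡0)
  ; eq⇒zero = eq⇒zero
  ; triangle = λ a b c → subst (ρ b a ≤_) (+-comm (ρ b c) (ρ c a)) (triangle b a c)
  }
  where
  open RealField ℝ
  open Quasimetric 𝒬

module Segments {ℝ : RealField} (𝒬 : Quasimetric ℝ) where
  open RealField ℝ
  open RealFieldProperties ℝ
  open Quasimetric 𝒬
  open CommutativeMonoidSolver commutativeMonoid using (solve; _⊜_; _⊕_)

  -- Proofs are named by the paper's notation for betweenness: pqr : q ∈[ p , r ].
  _∈[_,_] : Q → Q → Q → Set
  _∈[_,_] = Defs._∈[_,_] 𝒬

  ∈[]-of-≤ : ∀ {a b c} s → ρ a b + ρ b c + s ≤ ρ a c + s → b ∈[ a , c ]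
  ∈[]-of-≤ {a} {b} {c} s h = ≤-antisym (triangle a c b) (+-cancelʳ-≤ s h)

  ∈[]-antisym : ∀ {a b c} → b ∈[ a , c ] → c ∈[ a , b ] → b ≡ c
  ∈[]-antisym {a} {b} {c} abc acb =
    sym (zero⇒eq c b (x+y≡0⇒x≡0 (nonneg c b) (nonneg b c) (identityʳ-unique (ρ a c) _ loop)))
    where
    loop : ρ a c + (ρ c b + ρ b c) ≡ ρ a c
    loop = begin
      ρ a c + (ρ c b + ρ b c)  ≡⟨ +-assoc (ρ a c) (ρ c b) (ρ b c) ⟨
      ρ a c + ρ c b + ρ b c    ≡⟨ cong (_+ ρ b c) acb ⟨
      ρ a b + ρ b c            ≡⟨ abc ⟨
      ρ a c                    ∎
      where open ≡-Reasoning

  ∈[]-quadrilateral₁ : ∀ {a b c d} →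
    d ∈[ a , b ] → a ∈[ b , c ] → b ∈[ c , d ] → c ∈[ d , a ] → b ∈[ d , a ]
  ∈[]-quadrilateral₁ {a} {b} {c} {d} adb bac cbd dca =
    ∈[]-of-≤ s (subst₂ _≤_ left right sum)
    where
    s : Carrier
    s = ρ a d + ρ a c + ρ c b + ρ b d
    sum : ρ a b + ρ b c + ρ c d ≤ ρ a c + ρ c b + (ρ b d + ρ d c) + (ρ c a + ρ a d)
    sum = +-mono-≤ (+-mono-≤ (triangle a b c) (triangle b c d)) (triangle c d a)
    left : ρ a b + ρ b c + ρ c d ≡ ρ d b + ρ b a + s
    left = trans (cong₂ _+_ (cong₂ _+_ adb bac) cbd)
      (solve 6 (λ ad db ba ac cb bd →
        ((ad ⊕ db) ⊕ (ba ⊕ ac)) ⊕ (cb ⊕ bd) ⊜ (db ⊕ ba) ⊕ (((ad ⊕ ac) ⊕ cb) ⊕ bd)) refl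
        (ρ a d) (ρ d b) (ρ b a) (ρ a c) (ρ c b) (ρ b d))
    right : ρ a c + ρ c b + (ρ b d + ρ d c) + (ρ c a + ρ a d) ≡ ρ d a + s
    right = trans
      (solve 6 (λ ad ac cb bd dc ca →
        ((ac ⊕ cb) ⊕ (bd ⊕ dc)) ⊕ (ca ⊕ ad) ⊜ (dc ⊕ ca) ⊕ (((ad ⊕ ac) ⊕ cb) ⊕ bd)) refl
        (ρ a d) (ρ a c) (ρ c b) (ρ b d) (ρ d c) (ρ c a))
      (cong (_+ s) (sym dca))

  ∈[]-quadrilateral₂ : ∀ {a b c d} →
    b ∈[ a , d ] → a ∈[ b , c ] → d ∈[ c , b ] → c ∈[ d , a ] → b ∈[ d , a ]
  ∈[]-quadrilateral₂ {a} {b} {c} {d} abd bac cdb dca =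
    ∈[]-of-≤ s (subst₂ _≤_ left right sum)
    where
    s : Carrier
    s = ρ c d + ρ a c + ρ a b + ρ b d
    sum : ρ c b + ρ b c + ρ a d ≤ ρ c a + ρ a b + (ρ b d + ρ d c) + (ρ a c + ρ c d)
    sum = +-mono-≤ (+-mono-≤ (triangle c b a) (triangle b c d)) (triangle a d c)
    left : ρ c b + ρ b c + ρ a d ≡ ρ d b + ρ b a + s
    left = trans (cong₂ _+_ (cong₂ _+_ cdb bac) abd)
      (solve 6 (λ cd db ba ac ab bd →
        ((cd ⊕ db) ⊕ (ba ⊕ ac)) ⊕ (ab ⊕ bd) ⊜ (db ⊕ ba) ⊕ (((cd ⊕ ac) ⊕ ab) ⊕ bd)) refl
        (ρ c d) (ρ d b) (ρ b a) (ρ a c) (ρ a b) (ρ b d))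
    right : ρ c a + ρ a b + (ρ b d + ρ d c) + (ρ a c + ρ c d) ≡ ρ d a + s
    right = trans
      (solve 6 (λ cd ac ab bd dc ca →
        ((ca ⊕ ab) ⊕ (bd ⊕ dc)) ⊕ (ac ⊕ cd) ⊜ (dc ⊕ ca) ⊕ (((cd ⊕ ac) ⊕ ab) ⊕ bd)) refl
        (ρ c d) (ρ a c) (ρ a b) (ρ b d) (ρ d c) (ρ c a))
      (cong (_+ s) (sym dca))

module ConjugateSegments {ℝ : RealField} (𝒬 : Quasimetric ℝ) where
  open RealField ℝ
  open Quasimetric 𝒬
  open Segments 𝒬
  private module 𝒬ᶜ = Segments (conjugate 𝒬)

  ∈[]-conjugate : ∀ {a b c} → c ∈[ a , b ] → c 𝒬ᶜ.∈[ b , a ]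
  ∈[]-conjugate {a} {b} {c} acb = trans acb (+-comm (ρ a c) (ρ c b))

  ∈[]-unconjugate : ∀ {a b c} → c 𝒬ᶜ.∈[ b , a ] → c ∈[ a , b ]
  ∈[]-unconjugate {a} {b} {c} bca = trans bca (+-comm (ρ c b) (ρ a c))

  ∈[]-quadrilateral₁ᶜ : ∀ {a b c d} →
    d ∈[ b , a ] → a ∈[ c , b ] → b ∈[ d , c ] → c ∈[ a , d ] → b ∈[ a , d ]
  ∈[]-quadrilateral₁ᶜ bda cab dbc adc = ∈[]-unconjugate (𝒬ᶜ.∈[]-quadrilateral₁
    (∈[]-conjugate bda) (∈[]-conjugate cab) (∈[]-conjugate dbc) (∈[]-conjugate adc))

module Lines {ℝ : RealField} (𝒬 : Quasimetric ℝ) where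
  open RealField ℝ
  open RealFieldProperties ℝ using (+-identityˡ)
  open Quasimetric 𝒬
  open Segments 𝒬

  _∈Line_,_ : Q → Q → Q → Set
  _∈Line_,_ = Defs._∈Line_,_ 𝒬

  SameLine : Q × Q → Q × Q → Set
  SameLine = Defs.SameLine 𝒬

  before : ∀ {a b c} → a ∈[ c , b ] → c ∈Line a , b
  before = inj₁

  within : ∀ {a b c} → c ∈[ a , b ] → c ∈Line a , b
  within = inj₂ ∘ inj₁

  beyond : ∀ {a b c} → b ∈[ a , c ] → c ∈Line a , b
  beyond = inj₂ ∘ inj₂

  ∉Line : ∀ {a b c} → ¬ a ∈[ c , b ] → ¬ c ∈[ a , b ] → ¬ b ∈[ a , c ] → ¬ c ∈Line a , b
  ∉Line ¬cab _ _ (inj₁ cab) = ¬cab cab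
  ∉Line _ ¬acb _ (inj₂ (inj₁ acb)) = ¬acb acb
  ∉Line _ _ ¬abc (inj₂ (inj₂ abc)) = ¬abc abc

  start : ∀ {a b} → a ∈Line a , b
  start {a} {b} = within (sym (trans (cong (_+ ρ a b) (eq⇒zero a)) (+-identityˡ (ρ a b))))

  end : ∀ {a b} → b ∈Line a , b
  end {a} {b} = within (sym (trans (cong (ρ a b +_) (eq⇒zero b)) (+-idʳ (ρ a b))))

  lineSetoid : Setoid 0ℓ 0ℓ
  lineSetoid = record
    { Carrier = Q × Q
    ; _≈_ = SameLine
    ; isEquivalence = record
      { refl = λ _ → (λ c∈ → c∈) , (λ c∈ → c∈)
      ; sym = λ same c → proj₂ (same c) , proj₁ (same c)
      ; trans = λ same same′ c → proj₁ (same′ c) ∘ proj₁ (same c) , proj₂ (same c) ∘ proj₂ (same′ c)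
      }
    }

  open Unique lineSetoid public using (Unique; []; _∷_)

  apartˡ : ∀ {a b a′ b′} c → c ∈Line a , b → ¬ c ∈Line a′ , b′ → ¬ SameLine (a , b) (a′ , b′)
  apartˡ c c∈ab c∉a′b′ same = c∉a′b′ (proj₁ (same c) c∈ab)

  apartʳ : ∀ {a b a′ b′} c → ¬ c ∈Line a , b → c ∈Line a′ , b′ → ¬ SameLine (a , b) (a′ , b′)
  apartʳ c c∉ab c∈a′b′ same = c∉ab (proj₂ (same c) c∈a′b′)

  atLeast5Lines : (ls : Vec (Q × Q) 5) → All (uncurry _≢_) ls → Unique ls → AtLeast5Lines 𝒬
  atLeast5Lines ls proper unique =
    lookup ls , lookup⁺ proper , UniqueProperties.lookup-injective lineSetoid unique

module Configuration {ℝ : RealField} (𝒬 : Quasimetric ℝ) {x y z : Quasimetric.Q 𝒬}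
                     (only : OnlyBetw 𝒬 x y z) where
  open Quasimetric 𝒬
  open Segments 𝒬
  open ConjugateSegments 𝒬
  open Lines 𝒬

  x≢y : x ≢ y
  x≢y = proj₁ (proj₂ (proj₂ (proj₁ only)))

  x≢z : x ≢ z
  x≢z = proj₁ (proj₁ only)

  z≢y : z ≢ y
  z≢y = proj₁ (proj₂ (proj₁ only))

  y≢x : y ≢ x
  y≢x = ≢-sym x≢y

  z≢x : z ≢ x
  z≢x = ≢-sym x≢z

  y≢z : y ≢ z
  y≢z = ≢-sym z≢y

  xzy : z ∈[ x , y ]
  xzy = sym (proj₂ (proj₂ (proj₂ (proj₁ only))))

  private
    In3 : Q → Set
    In3 = Defs.In3 𝒬 x y z

    x∈xyz : In3 x
    x∈xyz = inj₁ refl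

    y∈xyz : In3 y
    y∈xyz = inj₂ (inj₁ refl)

    z∈xyz : In3 z
    z∈xyz = inj₂ (inj₂ refl)

    between⇒xzy : ∀ {a b c} → In3 a → In3 b → In3 c → a ≢ b → b ≢ c → a ≢ c →
      b ∈[ a , c ] → a ≡ x × b ≡ z × c ≡ y
    between⇒xzy a∈ b∈ c∈ a≢b b≢c a≢c abc = proj₂ only _ _ _ a∈ b∈ c∈ (a≢b , b≢c , a≢c , sym abc)

  ¬xyz : ¬ y ∈[ x , z ]
  ¬xyz xyz = y≢z (proj₁ (proj₂ (between⇒xzy x∈xyz y∈xyz z∈xyz x≢y y≢z x≢z xyz)))

  ¬yxz : ¬ x ∈[ y , z ]
  ¬yxz yxz = y≢x (proj₁ (between⇒xzy y∈xyz x∈xyz z∈xyz y≢x x≢z y≢z yxz))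

  ¬yzx : ¬ z ∈[ y , x ]
  ¬yzx yzx = y≢x (proj₁ (between⇒xzy y∈xyz z∈xyz x∈xyz y≢z z≢x y≢x yzx))

  ¬zxy : ¬ x ∈[ z , y ]
  ¬zxy zxy = z≢x (proj₁ (between⇒xzy z∈xyz x∈xyz y∈xyz z≢x x≢y z≢y zxy))

  ¬zyx : ¬ y ∈[ z , x ]
  ¬zyx zyx = z≢x (proj₁ (between⇒xzy z∈xyz y∈xyz x∈xyz z≢y y≢x z≢x zyx))

  z∉yx : ¬ z ∈Line y , x
  z∉yx = ∉Line ¬zyx ¬yzx ¬yxz

  y∉zx : ¬ y ∈Line z , x
  y∉zx = ∉Line ¬yzx ¬zyx ¬zxy

  x∉yz : ¬ x ∈Line y , z
  x∉yz = ∉Line ¬xyz ¬yxz ¬yzx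

  standardLines : Vec (Q × Q) 4
  standardLines = (x , y) ∷ (y , x) ∷ (z , x) ∷ (y , z) ∷ []

  standardLines-unique : Unique standardLines
  standardLines-unique =
    (apartˡ z (within xzy) z∉yx ∷ apartˡ y end y∉zx ∷ apartˡ x start x∉yz ∷ []) ∷
    (apartˡ y start y∉zx ∷ apartˡ x end x∉yz ∷ []) ∷
    (apartˡ x end x∉yz ∷ []) ∷
    [] ∷ []

  fifthLine : ∀ {a b} → a ≢ b → All (¬_ ∘ SameLine (a , b)) standardLines → AtLeast5Lines 𝒬
  fifthLine a≢b apart =
    atLeast5Lines _ (a≢b ∷ x≢y ∷ y≢x ∷ z≢x ∷ y≢z ∷ []) (apart ∷ standardLines-unique)

  fifthLine-trace-xyz : ∀ {a b} → a ≢ b → ¬ SameLine (a , b) (x , y) →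
    x ∈Line a , b → y ∈Line a , b → z ∈Line a , b → AtLeast5Lines 𝒬
  fifthLine-trace-xyz a≢b ≠xy x∈ y∈ z∈ =
    fifthLine a≢b (≠xy ∷ apartˡ z z∈ z∉yx ∷ apartˡ y y∈ y∉zx ∷ apartˡ x x∈ x∉yz ∷ [])

  fifthLine-trace-x : ∀ {a b} → a ≢ b → ¬ SameLine (a , b) (x , y) →
    x ∈Line a , b → ¬ y ∈Line a , b → ¬ z ∈Line a , b → AtLeast5Lines 𝒬
  fifthLine-trace-x a≢b ≠xy x∈ y∉ z∉ =
    fifthLine a≢b (≠xy ∷ apartʳ y y∉ start ∷ apartʳ z z∉ start ∷ apartˡ x x∈ x∉yz ∷ [])

  fifthLine-trace-y : ∀ {a b} → a ≢ b → ¬ SameLine (a , b) (x , y) →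
    ¬ x ∈Line a , b → y ∈Line a , b → ¬ z ∈Line a , b → AtLeast5Lines 𝒬
  fifthLine-trace-y a≢b ≠xy x∉ y∈ z∉ =
    fifthLine a≢b (≠xy ∷ apartʳ x x∉ end ∷ apartˡ y y∈ y∉zx ∷ apartʳ z z∉ end ∷ [])

  fifthLine-trace-z : ∀ {a b} → a ≢ b → ¬ SameLine (a , b) (x , y) →
    ¬ x ∈Line a , b → ¬ y ∈Line a , b → z ∈Line a , b → AtLeast5Lines 𝒬
  fifthLine-trace-z a≢b ≠xy x∉ y∉ z∈ =
    fifthLine a≢b (≠xy ∷ apartˡ z z∈ z∉yx ∷ apartʳ x x∉ end ∷ apartʳ y y∉ start ∷ [])

  module OffLine (em : ExcludedMiddle 0ℓ) {w : Q}
                 (w∉xy : ¬ w ∈Line x , y) (w∉xz : ¬ w ∈Line x , z) (w∉zy : ¬ w ∈Line z , y) where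

    ¬wxy : ¬ x ∈[ w , y ]
    ¬wxy = w∉xy ∘ before

    ¬xwy : ¬ w ∈[ x , y ]
    ¬xwy = w∉xy ∘ within

    ¬xyw : ¬ y ∈[ x , w ]
    ¬xyw = w∉xy ∘ beyond

    ¬wxz : ¬ x ∈[ w , z ]
    ¬wxz = w∉xz ∘ before

    ¬xwz : ¬ w ∈[ x , z ]
    ¬xwz = w∉xz ∘ within

    ¬xzw : ¬ z ∈[ x , w ]
    ¬xzw = w∉xz ∘ beyond

    ¬wzy : ¬ z ∈[ w , y ]
    ¬wzy = w∉zy ∘ before

    ¬zwy : ¬ w ∈[ z , y ]
    ¬zwy = w∉zy ∘ within

    w≢x : w ≢ x
    w≢x refl = w∉xy start

    w≢y : w ≢ y
    w≢y refl = w∉xy end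

    w≢z : w ≢ z
    w≢z refl = w∉xz end

    ≠xy : ∀ {a b} → w ∈Line a , b → ¬ SameLine (a , b) (x , y)
    ≠xy w∈ = apartˡ w w∈ w∉xy

    fifthLine-through-w : AtLeast5Lines 𝒬
    fifthLine-through-w
      with em {y ∈[ w , x ]} | em {y ∈[ w , z ]} | em {x ∈[ y , w ]} | em {x ∈[ z , w ]}
         | em {w ∈[ y , x ]} | em {w ∈[ z , x ]} | em {z ∈[ w , x ]} | em {w ∈[ y , z ]}
    ... | yes wyx | yes wyz | _ | _ | _ | _ | _ | _ =
      fifthLine-trace-xyz w≢y (≠xy start) (beyond wyx) end (beyond wyz)
    ... | no ¬wyx | no ¬wyz | _ | _ | _ | _ | _ | _ =
      fifthLine-trace-y w≢y (≠xy start) (∉Line ¬xwy ¬wxy ¬wyx) end (∉Line ¬zwy ¬wzy ¬wyz)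
    ... | _ | _ | no ¬yxw | no ¬zxw | _ | _ | _ | _ =
      fifthLine-trace-x (≢-sym w≢x) (≠xy end) start (∉Line ¬yxw ¬xyw ¬xwy) (∉Line ¬zxw ¬xzw ¬xwz)
    ... | yes wyx | _ | _ | _ | _ | _ | yes wzx | _ =
      fifthLine-trace-xyz w≢x (≠xy start) end (within wyx) (within wzx)
    ... | _ | _ | yes yxw | _ | yes ywx | _ | _ | _ =
      ⊥-elim (w≢x (∈[]-antisym ywx yxw))
    ... | _ | _ | _ | yes zxw | _ | yes zwx | _ | _ =
      ⊥-elim (w≢x (∈[]-antisym zwx zxw))
    ... | _ | yes wyz | yes yxw | _ | _ | yes zwx | _ | _ =
      ⊥-elim (¬zyx (∈[]-quadrilateral₁ xzy yxw wyz zwx))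
    ... | _ | yes wyz | _ | yes zxw | yes ywx | _ | _ | _ =
      ⊥-elim (¬yzx (∈[]-quadrilateral₂ xzy zxw wyz ywx))
    ... | yes wyx | _ | _ | yes zxw | _ | _ | _ | yes ywz =
      ⊥-elim (¬xwy (∈[]-quadrilateral₁ᶜ wyx zxw ywz xzy))
    ... | _ | _ | yes yxw | _ | _ | _ | _ | yes ywz =
      fifthLine-trace-xyz (≢-sym w≢y) (≠xy end) (within yxw) start (beyond ywz)
    ... | no ¬wyx | _ | _ | _ | no ¬ywx | no ¬zwx | no ¬wzx | _ =
      fifthLine-trace-x w≢x (≠xy start) end (∉Line ¬ywx ¬wyx ¬wxy) (∉Line ¬zwx ¬wzx ¬wxz)
    ... | _ | yes wyz | _ | _ | _ | _ | yes wzx | _ =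
      fifthLine-trace-xyz w≢z (≠xy start) (beyond wzx) (within wyz) end
    ... | _ | no ¬wyz | _ | _ | _ | _ | no ¬wzx | no ¬ywz =
      fifthLine-trace-z w≢z (≠xy start) (∉Line ¬xwz ¬wxz ¬wzx) (∉Line ¬ywz ¬wyz ¬wzy) end

mainTheorem5 : ExcludedMiddle 0ℓ → {ℝ : RealField} (𝒬 : Quasimetric ℝ) →
    (x y z : Quasimetric.Q 𝒬) → OnlyBetw 𝒬 x y z →
    HasUniversalLine 𝒬 ⊎ AtLeast5Lines 𝒬
mainTheorem5 em 𝒬 x y z only = universalOr5Lines
  where
  open Lines 𝒬
  open Configuration 𝒬 only

  universalOr5Lines : HasUniversalLine 𝒬 ⊎ AtLeast5Lines 𝒬
  universalOr5Lines
    with em {SameLine (x , z) (x , y)} | em {SameLine (z , y) (x , y)} | em⇒∀⊎∃¬ em (_∈Line x , y)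
  ... | no xz≠xy | _ | _ = inj₂ (fifthLine-trace-xyz x≢z xz≠xy start (beyond xzy) end)
  ... | _ | no zy≠xy | _ = inj₂ (fifthLine-trace-xyz z≢y zy≠xy (before xzy) end start)
  ... | _ | _ | inj₁ universal = inj₁ (x , y , x≢y , universal)
  ... | yes xz=xy | yes zy=xy | inj₂ (w , w∉xy) =
    inj₂ (OffLine.fifthLine-through-w em w∉xy (w∉xy ∘ proj₁ (xz=xy w)) (w∉xy ∘ proj₁ (zy=xy w)))
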